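{- Let $n \ge 4$. Suppose $M$ is a minimal identified stacked sphere (MISS) of dimension $n-1$ that is obtained by handle addition on a stacked sphere $\Delta$ (with a fixed sequence of subdivisions producing $\Delta$). Then $\Delta$ has at most two stacks, and the top of every stack contains one of the two identified facets.
   Context: A stacked $(n-1)$-sphere $\Delta$ is obtained from the boundary of an $n$-simplex by a sequence of subdivisions $s_1, s_2, \dots$, where subdividing a facet $\{u_1,\dots,u_n\}$ with a new vertex $v'$ replaces it by the $n$ facets obtained by replacing one $u_i$ by $v'$. A stack is the set of facets created by a maximal subsequence of subdivisions $s_{i_1}, \dots, s_{i_k}$ in which each $s_{i_j}$ subdivides a facet created by $s_{i_{j-1}}$; the top of the stack is the set of facets created by its last subdivision, and the top vertex is the vertex introduced by that last subdivision. An $l$-stacked sphere is one with $l$ stacks. Handle addition on a triangulation of $S^{n-1}$: choose two disjoint facets and a bijection between their vertices such that each pair of corresponding vertices is at edge-path distance at least three, identify corresponding vertices, and remove the identified facet; the result is a simplicial complex homeomorphic to an $S^{n-2}$-bundle over $S^1$. A MISS (minimal identified stacked sphere) is a triangulation of an $S^{n-2}$-bundle over $S^1$ with exactly $2n+1$ vertices. -}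

module Defs where

open import Data.Nat using (ℕ; zero; suc; _+_; _*_; _≤_; _≟_)
open import Data.Maybe using (Maybe; just; nothing)
import Data.Maybe.Properties as MaybeP
open import Data.Product using (Σ; ∃; _×_; _,_; proj₁; proj₂)
open import Data.List using (List; []; _∷_; _++_; [_]; map; filter; upTo; length; zip; concat; deduplicate)
import Data.List.Properties as ListP
open import Data.List.Membership.Propositional using (_∈_; _∉_)
open import Data.List.Relation.Unary.Any as Any using (Any; any?)
open import Data.List.Relation.Unary.All using (All)
open import Data.List.Relation.Binary.Permutation.Propositional using (_↭_)
open import Relation.Nullary using (¬_; ¬?; yes; no)
open import Relation.Nullary.Decidable using (_×-dec_)
open import Relation.Binary.PropositionalEquality using (_≡_; _≢_)

-- Vertices are natural numbers; a facet is a list of (distinct) vertices.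
Facet : Set
Facet = List ℕ

-- A facet tagged with the subdivision that created it:
-- nothing  = facet of the initial boundary of the n-simplex,
-- just i   = facet created by the i-th subdivision s_i (0-indexed).
Tagged : Set
Tagged = Maybe ℕ × Facet

-- State of a stacked sphere built by a recorded sequence of subdivisions.
--   facets  : current facets, tagged with their creating subdivision
--   parents : for the i-th subdivision, the tag of the facet it subdivided
--             (so  parents[j] = just i  means  s_j subdivides a facet created by s_i)
record State : Set where
  constructor mkState
  field
    facets  : List Tagged
    parents : List (Maybe ℕ)
open State public

_without_ : Facet → ℕ → Facet
F without u = filter (λ w → ¬? (w ≟ u)) F

-- boundary of the n-simplex on vertices 0,…,n : facets are the n-subsets
initial : ℕ → State
initial n = mkState (map (λ i → (nothing , upTo (suc n) without i)) (upTo (suc n))) []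

steps : State → ℕ
steps S = length (parents S)

subdivide : (n : ℕ) (S : State) {e : Tagged} → e ∈ facets S → State
subdivide n S {e} p =
  mkState ((facets S Any.─ p)
             ++ map (λ u → (just (steps S) , (suc n + steps S) ∷ (proj₂ e without u))) (proj₂ e))
          (parents S ++ [ proj₁ e ])

-- S is a stacked (n-1)-sphere obtained from ∂(n-simplex) by the recorded
-- sequence of subdivisions
data Stacked (n : ℕ) : State → Set where
  init : Stacked n (initial n)
  sub  : ∀ {S e} → Stacked n S → (p : e ∈ facets S) → Stacked n (subdivide n S p)

facetsOf : State → List Facet
facetsOf S = map proj₂ (facets S)

-- The subdivisions form a forest (s_j is a child of s_i iff s_j
-- subdivides a facet created by s_i).  A stack is a maximal chain
-- s_{i_1},…,s_{i_k}, i.e. a root-to-leaf path; it is determined by its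
-- last subdivision, a leaf: a subdivision none of whose created facets
-- is later subdivided.  We index stacks by the index of their last subdivision.
stacks : State → List ℕ
stacks S = filter (λ i → ¬? (any? (λ q → MaybeP.≡-dec _≟_ q (just i)) (parents S)))
                  (upTo (steps S))

-- top of the stack whose last subdivision is s_i : the facets created by s_i
Top : State → ℕ → List Facet
Top S i = map proj₂ (filter (λ e → MaybeP.≡-dec _≟_ (proj₁ e) (just i)) (facets S))

Adj : State → ℕ → ℕ → Set
Adj S u v = u ≢ v × Σ Facet (λ F → F ∈ facetsOf S × u ∈ F × v ∈ F)

DistGE3 : State → ℕ → ℕ → Set
DistGE3 S u v = u ≢ v × ¬ Adj S u v × ¬ (Σ ℕ λ w → Adj S u w × Adj S w v)

-- Handle addition.  The bijection σ → τ is given by pairing the k-th vertex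
-- of σ with the k-th vertex of τ', where τ' is a reordering of τ.
record HandleAddition (S : State) : Set where
  field
    σ τ τ'   : Facet
    σ∈       : σ ∈ facetsOf S
    τ∈       : τ ∈ facetsOf S
    disjoint : ∀ v → v ∈ σ → v ∉ τ
    perm     : τ' ↭ τ
    far      : All (λ ab → DistGE3 S (proj₁ ab) (proj₂ ab)) (zip σ τ')
open HandleAddition public

identify : List (ℕ × ℕ) → ℕ → ℕ
identify [] v = v
identify ((a , b) ∷ ps) v with b ≟ v
... | yes _ = a
... | no  _ = identify ps v

-- facets of the complex M obtained by handle addition: identify the
-- vertices and remove the identified facet (the common image of σ and τ)
handleFacets : (S : State) → HandleAddition S → List Facet
handleFacets S h =
  map (map (identify (zip (σ h) (τ' h))))
      (filter (λ F → ¬? (ListP.≡-dec _≟_ F (σ h)) ×-dec ¬? (ListP.≡-dec _≟_ F (τ h)))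
              (facetsOf S))

handleVertexCount : (S : State) → HandleAddition S → ℕ
handleVertexCount S h = length (deduplicate _≟_ (concat (handleFacets S h)))

-- M is a MISS: it has exactly 2n+1 vertices
IsMISS : ℕ → (S : State) → HandleAddition S → Set
IsMISS n S h = handleVertexCount S h ≡ 2 * n + 1

-- Pair the vertices of σ and τ by the handle bijection and give a pair (a, b) the level
-- min(d(a, b) − 1, 2), where d is the edge-path distance. Undo the last subdivision (new vertex v,
-- subdividing F): a facet through v becomes F by putting back the vertex u of F that it omits.
-- Edges only disappear, and as v is adjacent to u a pair (v, b) loses at most one level when v is
-- replaced by u. If exactly one of σ, τ contains v, that facet is on top of the stack ending with
-- this subdivision; if both do, every pair through v already has level 0. By induction over the
-- subdivisions the total level is at most their number, and strictly smaller when some stack has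
-- neither σ nor τ on its top. For the handle addition every pair has level 2, so the total is 2n.
-- On the other hand, after s subdivisions Δ has n + 1 + s vertices and all those outside τ survive
-- in M, so a MISS has s ≤ 2n. Hence every stack top contains σ or τ; as a facet determines the subdivision that created it,
-- there are at most two stacks.

module Submission where

open import Defs
open import Data.Nat using (ℕ; zero; suc; pred; _+_; _*_; _∸_; _≤_; _<_; _≟_; _≤?_; z≤n; s≤s)
open import Data.Nat.Properties
open import Data.Maybe using (Maybe; just; nothing)
import Data.Maybe.Properties as Maybe
open import Data.Product using (∃₂; ∃-syntax; _×_; _,_; proj₁; proj₂)
open import Data.Sum using (_⊎_; inj₁; inj₂)
open import Data.Empty using (⊥-elim)
open import Data.List using (List; []; _∷_; _++_; map; upTo; length; zip; concat; deduplicate)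
import Data.List.Properties as List
open import Data.List.Membership.Propositional using (_∈_; _∉_; find)
open import Data.List.Membership.Propositional.Properties
  using (∈-map⁺; ∈-map⁻; ∈-filter⁺; ∈-filter⁻; ∈-upTo⁺; ∈-upTo⁻; ∈-++⁺ˡ; ∈-++⁺ʳ; ∈-++⁻
        ; ∈-concat⁺′; ∈-deduplicate⁺)
open import Data.List.Membership.DecPropositional _≟_ using (_∈?_)
open import Data.List.Membership.DecPropositional (List.≡-dec _≟_) using () renaming (_∈?_ to _∈ᶠ?_)
open import Data.List.Relation.Binary.Subset.Propositional using (_⊆_)
open import Data.List.Relation.Unary.Any as Any using (Any; here; there; index)
open import Data.List.Relation.Unary.All as All using (All; []; _∷_; all?)
open import Data.List.Relation.Unary.All.Properties using (¬All⇒Any¬) renaming (map⁺ to All-map⁺)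
open import Data.List.Relation.Unary.Unique.Propositional using (Unique; []; _∷_)
import Data.List.Relation.Unary.Unique.Propositional.Properties as Unique
import Data.List.Relation.Unary.Any.Properties as AnyP
open import Data.List.Relation.Binary.Permutation.Propositional using (↭-sym; ↭⇒↭ₛ)
open import Data.List.Relation.Binary.Permutation.Propositional.Properties using (↭-length; ∈-resp-↭)
open import Data.List.Relation.Binary.Permutation.Setoid.Properties using (Unique-resp-↭)
open import Function using (_∘_; case_of_)
open import Relation.Binary.PropositionalEquality
  using (_≡_; _≢_; refl; sym; trans; cong; cong₂; subst; ≢-sym; setoid; module ≡-Reasoning)
open import Relation.Nullary using (¬_; ¬?; Dec; yes; no)

module _ {A : Set} where

  ∈-─⁻ : ∀ {x e : A} {xs} (e∈xs : e ∈ xs) → x ∈ xs → x ≡ e ⊎ x ∈ (xs Any.─ e∈xs)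
  ∈-─⁻ (here refl) (here refl) = inj₁ refl
  ∈-─⁻ (here _)    (there x∈)  = inj₂ x∈
  ∈-─⁻ (there _)   (here refl) = inj₂ (here refl)
  ∈-─⁻ (there e∈)  (there x∈)  with ∈-─⁻ e∈ x∈
  ... | inj₁ x≡e = inj₁ x≡e
  ... | inj₂ x∈─ = inj₂ (there x∈─)

  ─-⊆ : ∀ {e : A} {xs} (e∈xs : e ∈ xs) → (xs Any.─ e∈xs) ⊆ xs
  ─-⊆ (here _)   x∈         = there x∈
  ─-⊆ (there _)  (here x≡y) = here x≡y
  ─-⊆ (there e∈) (there x∈) = there (─-⊆ e∈ x∈)

  Unique-⊆⇒length≤ : ∀ {xs ys : List A} → Unique xs → xs ⊆ ys → length xs ≤ length ys
  Unique-⊆⇒length≤ {[]}          _            _     = z≤n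
  Unique-⊆⇒length≤ {x ∷ xs} {ys} (x∉xs ∷ xs!) xs⊆ys = begin
    suc (length xs)              ≤⟨ s≤s (Unique-⊆⇒length≤ xs! xs⊆ys─x) ⟩
    suc (length (ys Any.─ x∈ys)) ≡⟨ List.length-removeAt′ ys (index x∈ys) ⟨
    length ys                    ∎
    where
    open ≤-Reasoning
    x∈ys = xs⊆ys (here refl)
    xs⊆ys─x : xs ⊆ (ys Any.─ x∈ys)
    xs⊆ys─x y∈xs with ∈-─⁻ x∈ys (xs⊆ys (there y∈xs))
    ... | inj₁ refl = ⊥-elim (All.lookup x∉xs y∈xs refl)
    ... | inj₂ y∈   = y∈

∃-∉ : ∀ {xs ys : List ℕ} → Unique xs → length ys < length xs → ∃[ w ] w ∈ xs × w ∉ ys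
∃-∉ {xs} {ys} xs! ys<xs with all? (_∈? ys) xs
... | yes xs⊆ys = ⊥-elim (<⇒≱ ys<xs (Unique-⊆⇒length≤ xs! (All.lookup xs⊆ys)))
... | no  xs⊈ys = find (¬All⇒Any¬ (_∈? ys) xs xs⊈ys)

avoiding₂ : ∀ {xs} → Unique xs → 3 ≤ length xs → ∀ a b → ∃[ w ] w ∈ xs × w ≢ a × w ≢ b
avoiding₂ xs! 3≤|xs| a b with ∃-∉ {ys = a ∷ b ∷ []} xs! 3≤|xs|
... | w , w∈xs , w∉ab = w , w∈xs , w∉ab ∘ here , w∉ab ∘ there ∘ here

differs? : ∀ u w → Dec (w ≢ u)
differs? u w = ¬? (w ≟ u)

∈-without⁺ : ∀ {x u F} → x ∈ F → x ≢ u → x ∈ F without u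
∈-without⁺ {u = u} = ∈-filter⁺ (differs? u)

∈-without⁻ : ∀ {x u F} → x ∈ F without u → x ∈ F × x ≢ u
∈-without⁻ {u = u} = ∈-filter⁻ (differs? u)

Unique-without : ∀ {u F} → Unique F → Unique (F without u)
Unique-without {u} = Unique.filter⁺ (differs? u)

length-without : ∀ {u} F → Unique F → u ∈ F → suc (length (F without u)) ≡ length F
length-without (x ∷ F) (x∉F ∷ _) (here refl) = cong (suc ∘ length) (begin
  (x ∷ F) without x ≡⟨ List.filter-reject (differs? x) (λ x≢x → x≢x refl) ⟩
  F without x       ≡⟨ List.filter-all (differs? x) (All.map ≢-sym x∉F) ⟩
  F                 ∎)
  where open ≡-Reasoning
length-without {u} (x ∷ F) (x∉F ∷ F!) (there u∈F) = begin
  suc (length ((x ∷ F) without u)) ≡⟨ cong (suc ∘ length) (List.filter-accept (differs? u) x≢u) ⟩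
  suc (suc (length (F without u))) ≡⟨ cong suc (length-without F F! u∈F) ⟩
  suc (length F)                   ∎
  where
  open ≡-Reasoning
  x≢u : x ≢ u
  x≢u refl = All.lookup x∉F u∈F refl

without-≢ : ∀ {w w′ F} → w ∈ F → w ≢ w′ → F without w ≢ F without w′
without-≢ {w} {F = F} w∈F w≢w′ eq =
  proj₂ (∈-without⁻ {F = F} (subst (w ∈_) (sym eq) (∈-without⁺ w∈F w≢w′))) refl

two-omissions : ∀ {F} → Unique F → 3 ≤ length F → ∀ x →
  ∃₂ λ w₁ w₂ → w₁ ∈ F × w₂ ∈ F × w₁ ≢ w₂ × x ≢ w₁ × x ≢ w₂
two-omissions F! 3≤|F| x with avoiding₂ F! 3≤|F| x x
... | w₁ , w₁∈F , w₁≢x , _ with avoiding₂ F! 3≤|F| x w₁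
... | w₂ , w₂∈F , w₂≢x , w₂≢w₁ =
  w₁ , w₂ , w₁∈F , w₂∈F , ≢-sym w₂≢w₁ , ≢-sym w₁≢x , ≢-sym w₂≢x

-- The creating subdivision of a facet can be read off its first vertex: subdivision sᵢ
-- introduces the vertex n + 1 + i and lists it first in every facet it creates.
creator : ℕ → Facet → Maybe ℕ
creator n []      = nothing
creator n (x ∷ _) with x ≤? n
... | yes _ = nothing
... | no  _ = just (x ∸ suc n)

creator-initial : ∀ {n G} → All (_< suc n) G → creator n G ≡ nothing
creator-initial {G = []}    []          = refl
creator-initial {n} {x ∷ _} (x<1+n ∷ _) with x ≤? n
... | yes _   = refl
... | no  x≰n = ⊥-elim (x≰n (≤-pred x<1+n))

creator-new : ∀ {n i xs} → creator n (suc n + i ∷ xs) ≡ just i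
creator-new {n} {i} with suc n + i ≤? n
... | yes 1+n+i≤n = ⊥-elim (1+n≰n (m+n≤o⇒m≤o (suc n) 1+n+i≤n))
... | no  _       = cong just (m+n∸m≡n (suc n) i)

record WellFormed (n B : ℕ) (e : Tagged) : Set where
  field
    tag≡creator : proj₁ e ≡ creator n (proj₂ e)
    size        : length (proj₂ e) ≡ n
    unique      : Unique (proj₂ e)
    bounded     : All (_< B) (proj₂ e)

WellFormed-weaken : ∀ {n B B′ e} → B ≤ B′ → WellFormed n B e → WellFormed n B′ e
WellFormed-weaken B≤B′ wf = record
  { tag≡creator = tag≡creator
  ; size        = size
  ; unique      = unique
  ; bounded     = All.map (λ x<B → ≤-trans x<B B≤B′) bounded
  }
  where open WellFormed wf

InTwoFacets : State → ℕ → Set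
InTwoFacets S x =
  ∃₂ λ G₁ G₂ → G₁ ∈ facetsOf S × G₂ ∈ facetsOf S × G₁ ≢ G₂ × x ∈ G₁ × x ∈ G₂

vertexBound : ℕ → State → ℕ
vertexBound n S = suc n + steps S

record Invariant (n : ℕ) (S : State) : Set where
  field
    well-formed   : All (WellFormed n (vertexBound n S)) (facets S)
    in-two-facets : ∀ x → x < vertexBound n S → InTwoFacets S x

tagged⁻ : ∀ S {G} → G ∈ facetsOf S → ∃[ t ] (t , G) ∈ facets S
tagged⁻ S G∈ with ∈-map⁻ proj₂ G∈
... | (t , _) , tG∈ , refl = t , tG∈

tagged⁺ : ∀ S {t G} → (t , G) ∈ facets S → G ∈ facetsOf S
tagged⁺ S = ∈-map⁺ proj₂

createdBy? : ∀ j (e : Tagged) → Dec (proj₁ e ≡ just j)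
createdBy? j e = Maybe.≡-dec _≟_ (proj₁ e) (just j)

Top⁺ : ∀ {S j G} → (just j , G) ∈ facets S → G ∈ Top S j
Top⁺ {j = j} jG∈ = ∈-map⁺ proj₂ (∈-filter⁺ (createdBy? j) jG∈ refl)

Top⁻ : ∀ {S j G} → G ∈ Top S j → (just j , G) ∈ facets S
Top⁻ {S} {j} G∈ with ∈-map⁻ proj₂ G∈
... | _ , tG∈ , refl with ∈-filter⁻ (createdBy? j) {xs = facets S} tG∈
... | jG∈ , refl = jG∈

NotParent : State → ℕ → Set
NotParent S j = ¬ Any (_≡ just j) (parents S)

notParent? : ∀ S j → Dec (NotParent S j)
notParent? S j = ¬? (Any.any? (λ q → Maybe.≡-dec _≟_ q (just j)) (parents S))

∈-stacks⁺ : ∀ {S j} → j < steps S → NotParent S j → j ∈ stacks S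
∈-stacks⁺ {S} j<k = ∈-filter⁺ (notParent? S) (∈-upTo⁺ j<k)

∈-stacks⁻ : ∀ {S j} → j ∈ stacks S → j < steps S × NotParent S j
∈-stacks⁻ {S} j∈ with ∈-filter⁻ (notParent? S) {xs = upTo (steps S)} j∈
... | j∈upTo , notParent = ∈-upTo⁻ j∈upTo , notParent

Unique-stacks : ∀ S → Unique (stacks S)
Unique-stacks S = Unique.filter⁺ (notParent? S) (Unique.upTo⁺ (steps S))

module _ {n S} (inv : Invariant n S) where
  open Invariant inv

  well-formed⁻ : ∀ {t G} → (t , G) ∈ facets S → WellFormed n (vertexBound n S) (t , G)
  well-formed⁻ = All.lookup well-formed

  facet-size : ∀ {G} → G ∈ facetsOf S → length G ≡ n
  facet-size G∈ = WellFormed.size (well-formed⁻ (proj₂ (tagged⁻ S G∈)))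

  facet-unique : ∀ {G} → G ∈ facetsOf S → Unique G
  facet-unique G∈ = WellFormed.unique (well-formed⁻ (proj₂ (tagged⁻ S G∈)))

  facet-bounded : ∀ {G x} → G ∈ facetsOf S → x ∈ G → x < vertexBound n S
  facet-bounded G∈ = All.lookup (WellFormed.bounded (well-formed⁻ (proj₂ (tagged⁻ S G∈))))

  Top-creator : ∀ {G j} → G ∈ Top S j → creator n G ≡ just j
  Top-creator G∈ = sym (WellFormed.tag≡creator (well-formed⁻ (Top⁻ {S} G∈)))

  length-stacks-≤2 : ∀ {σ τ} → (∀ i → i ∈ stacks S → σ ∈ Top S i ⊎ τ ∈ Top S i) →
                     length (stacks S) ≤ 2
  length-stacks-≤2 {σ} {τ} covered = begin
    length (stacks S)            ≡⟨ List.length-map just (stacks S) ⟨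
    length (map just (stacks S)) ≤⟨ Unique-⊆⇒length≤ Unique-creators ⊆creators ⟩
    2                            ∎
    where
    open ≤-Reasoning
    Unique-creators : Unique (map just (stacks S))
    Unique-creators = Unique.map⁺ Maybe.just-injective (Unique-stacks S)
    ⊆creators : map just (stacks S) ⊆ creator n σ ∷ creator n τ ∷ []
    ⊆creators ji∈ with ∈-map⁻ just ji∈
    ... | i , i∈ , refl with covered i i∈
    ... | inj₁ σ∈Top = here (sym (Top-creator σ∈Top))
    ... | inj₂ τ∈Top = there (here (sym (Top-creator τ∈Top)))

Adj-sym : ∀ {S a b} → Adj S a b → Adj S b a
Adj-sym (a≢b , G , G∈ , a∈G , b∈G) = ≢-sym a≢b , G , G∈ , b∈G , a∈G

Close : State → ℕ → ℕ → Set
Close S a b = a ≡ b ⊎ Adj S a b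

Close-cofacial : ∀ {S G a b} → G ∈ facetsOf S → a ∈ G → b ∈ G → Close S a b
Close-cofacial {a = a} {b} G∈ a∈G b∈G with a ≟ b
... | yes a≡b = inj₁ a≡b
... | no  a≢b = inj₂ (a≢b , _ , G∈ , a∈G , b∈G)

-- Apart S l a b : the edge-path distance from a to b in S exceeds l (for l ≤ 2).
data Apart (S : State) : ℕ → ℕ → ℕ → Set where
  apart₀ : ∀ {a b} → Apart S 0 a b
  apart₁ : ∀ {a b} → a ≢ b → ¬ Adj S a b → Apart S 1 a b
  apart₂ : ∀ {a b} → DistGE3 S a b → Apart S 2 a b

data Separated (S : State) : List ℕ → List ℕ → ℕ → Set where
  []  : Separated S [] [] 0
  _∷_ : ∀ {l a b as bs m} → Apart S l a b → Separated S as bs m → Separated S (a ∷ as) (b ∷ bs) (l + m)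

Apart-close : ∀ {S l a b} → Apart S l a b → Close S a b → l ≡ 0
Apart-close apart₀                  _           = refl
Apart-close (apart₁ a≢b _)          (inj₁ a≡b)  = ⊥-elim (a≢b a≡b)
Apart-close (apart₁ _ ¬adj)         (inj₂ adj)  = ⊥-elim (¬adj adj)
Apart-close (apart₂ (a≢b , _))      (inj₁ a≡b)  = ⊥-elim (a≢b a≡b)
Apart-close (apart₂ (_ , ¬adj , _)) (inj₂ adj)  = ⊥-elim (¬adj adj)

Separated-close : ∀ {S as bs m} → (∀ {a b} → a ∈ as → b ∈ bs → Close S a b) →
                  Separated S as bs m → m ≡ 0
Separated-close close []         = refl
Separated-close close (ap ∷ sep) =
  cong₂ _+_ (Apart-close ap (close (here refl) (here refl)))
            (Separated-close (λ a∈ b∈ → close (there a∈) (there b∈)) sep)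

module _ {S S′ : State} (fewer-edges : ∀ {x y} → Adj S′ x y → Adj S x y) where

  Apart-mono : ∀ {l a b} → Apart S l a b → Apart S′ l a b
  Apart-mono apart₀                        = apart₀
  Apart-mono (apart₁ a≢b ¬adj)             = apart₁ a≢b (¬adj ∘ fewer-edges)
  Apart-mono (apart₂ (a≢b , ¬adj , ¬path)) =
    apart₂ (a≢b , ¬adj ∘ fewer-edges ,
            λ (w , adj₁ , adj₂) → ¬path (w , fewer-edges adj₁ , fewer-edges adj₂))

  Separated-mono : ∀ {as bs m} → Separated S as bs m → Separated S′ as bs m
  Separated-mono []         = []
  Separated-mono (ap ∷ sep) = Apart-mono ap ∷ Separated-mono sep

Apart-sym : ∀ {S l a b} → Apart S l a b → Apart S l b a
Apart-sym     apart₀                        = apart₀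
Apart-sym {S} (apart₁ a≢b ¬adj)             = apart₁ (≢-sym a≢b) (¬adj ∘ Adj-sym {S})
Apart-sym {S} (apart₂ (a≢b , ¬adj , ¬path)) =
  apart₂ (≢-sym a≢b , ¬adj ∘ Adj-sym {S} ,
          λ (w , adj₁ , adj₂) → ¬path (w , Adj-sym {S} adj₂ , Adj-sym {S} adj₁))

Separated-sym : ∀ {S as bs m} → Separated S as bs m → Separated S bs as m
Separated-sym []         = []
Separated-sym (ap ∷ sep) = Apart-sym ap ∷ Separated-sym sep

Separated-far : ∀ {S} as bs → length as ≡ length bs →
                All (λ ab → DistGE3 S (proj₁ ab) (proj₂ ab)) (zip as bs) →
                Separated S as bs (2 * length as)
Separated-far []       []       _         _            = []
Separated-far (a ∷ as) (b ∷ bs) |as|≡|bs| (far ∷ fars) =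
  subst (Separated _ (a ∷ as) (b ∷ bs)) (sym (*-suc 2 (length as)))
        (apart₂ far ∷ Separated-far as bs (suc-injective |as|≡|bs|) fars)

record Matching (σ τ : Facet) (as bs : List ℕ) : Set where
  field
    as⊆σ      : as ⊆ σ
    bs⊆τ      : bs ⊆ τ
    as-unique : Unique as
    bs-unique : Unique bs

Matching-sym : ∀ {σ τ as bs} → Matching σ τ as bs → Matching τ σ bs as
Matching-sym M = record { as⊆σ = bs⊆τ ; bs⊆τ = as⊆σ ; as-unique = bs-unique ; bs-unique = as-unique }
  where open Matching M

Uncovered : State → Facet → Facet → Set
Uncovered S σ τ = ∃[ j ] j ∈ stacks S × σ ∉ Top S j × τ ∉ Top S j

Uncovered-sym : ∀ {S σ τ} → Uncovered S σ τ → Uncovered S τ σ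
Uncovered-sym (j , j∈ , σ∉Top , τ∉Top) = j , j∈ , τ∉Top , σ∉Top

SeparationBound : State → Facet → Facet → ℕ → Set
SeparationBound S σ τ m = m ≤ steps S × (Uncovered S σ τ → m < steps S)

replace : ℕ → ℕ → ℕ → ℕ
replace v u a with a ≟ v
... | yes _ = u
... | no  _ = a

replace-self : ∀ v u → replace v u v ≡ u
replace-self v u with v ≟ v
... | yes _   = refl
... | no  v≢v = ⊥-elim (v≢v refl)

replace-≢ : ∀ {v u a} → a ≢ v → replace v u a ≡ a
replace-≢ {v} {u} {a} a≢v with a ≟ v
... | yes a≡v = ⊥-elim (a≢v a≡v)
... | no  _   = refl

replace-injective : ∀ {v u x y} → x ≢ y → x ≢ u → y ≢ u → replace v u x ≢ replace v u y
replace-injective {v} {u} {x} {y} x≢y x≢u y≢u with x ≟ v | y ≟ v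
... | yes refl | yes refl = ⊥-elim (x≢y refl)
... | yes _    | no  _    = y≢u ∘ sym
... | no  _    | yes _    = x≢u
... | no  _    | no  _    = x≢y

map-replace-∉ : ∀ {v u as} → v ∉ as → map (replace v u) as ≡ as
map-replace-∉ {as = []}     _    = refl
map-replace-∉ {as = a ∷ as} v∉as =
  cong₂ _∷_ (replace-≢ (λ a≡v → v∉as (here (sym a≡v)))) (map-replace-∉ (v∉as ∘ there))

Unique-map-replace : ∀ {v u as} → Unique as → u ∉ as → Unique (map (replace v u) as)
Unique-map-replace {as = []}     []            _    = []
Unique-map-replace {v} {u} {a ∷ as} (a∉as ∷ as!) u∉as =
  All-map⁺ (All.tabulate fresh) ∷ Unique-map-replace as! (u∉as ∘ there)
  where
  fresh : ∀ {y} → y ∈ as → replace v u a ≢ replace v u y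
  fresh {y} y∈as = replace-injective (All.lookup a∉as y∈as) (u∉as ∘ here ∘ sym) y≢u
    where
    y≢u : y ≢ u
    y≢u y≡u = u∉as (there (subst (_∈ as) y≡u y∈as))

module Initial {n} (n≥3 : 3 ≤ n) where

  V : List ℕ
  V = upTo (suc n)

  Unique-V : Unique V
  Unique-V = Unique.upTo⁺ (suc n)

  3≤|V| : 3 ≤ length V
  3≤|V| = subst (3 ≤_) (sym (List.length-upTo (suc n))) (m≤n⇒m≤1+n n≥3)

  vertexBound-initial : vertexBound n (initial n) ≡ suc n
  vertexBound-initial = +-identityʳ (suc n)

  facet∈ : ∀ {i} → i ∈ V → V without i ∈ facetsOf (initial n)
  facet∈ i∈V = ∈-map⁺ proj₂ (∈-map⁺ (λ i → nothing , V without i) i∈V)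

  well-formed : ∀ {i} → i ∈ V → WellFormed n (vertexBound n (initial n)) (nothing , V without i)
  well-formed {i} i∈V = record
    { tag≡creator = sym (creator-initial <1+n)
    ; size        = suc-injective (trans (length-without V Unique-V i∈V) (List.length-upTo (suc n)))
    ; unique      = Unique-without {i} Unique-V
    ; bounded     = subst (λ B → All (_< B) (V without i)) (sym vertexBound-initial) <1+n
    }
    where
    <1+n : All (_< suc n) (V without i)
    <1+n = All.tabulate (∈-upTo⁻ ∘ proj₁ ∘ ∈-without⁻ {u = i} {V})

  in-two-facets : ∀ x → x < vertexBound n (initial n) → InTwoFacets (initial n) x
  in-two-facets x x<B with two-omissions Unique-V 3≤|V| x
  ... | w₁ , w₂ , w₁∈V , w₂∈V , w₁≢w₂ , x≢w₁ , x≢w₂ =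
    V without w₁ , V without w₂ , facet∈ w₁∈V , facet∈ w₂∈V , without-≢ w₁∈V w₁≢w₂ ,
    ∈-without⁺ x∈V x≢w₁ , ∈-without⁺ x∈V x≢w₂
    where
    x∈V : x ∈ V
    x∈V = ∈-upTo⁺ (subst (x <_) vertexBound-initial x<B)

  invariant : Invariant n (initial n)
  invariant = record
    { well-formed   = All-map⁺ (All.tabulate well-formed)
    ; in-two-facets = in-two-facets
    }

  close : ∀ {a b} → a < suc n → b < suc n → Close (initial n) a b
  close {a} {b} a<1+n b<1+n with avoiding₂ Unique-V 3≤|V| a b
  ... | w , w∈V , w≢a , w≢b =
    Close-cofacial {initial n} (facet∈ w∈V) (∈-without⁺ (∈-upTo⁺ a<1+n) (≢-sym w≢a))
                                            (∈-without⁺ (∈-upTo⁺ b<1+n) (≢-sym w≢b))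

  separation-bound : ∀ {σ τ as bs m} → σ ∈ facetsOf (initial n) → τ ∈ facetsOf (initial n) →
                     Matching σ τ as bs → Separated (initial n) as bs m → SeparationBound (initial n) σ τ m
  separation-bound {as = as} {bs} σ∈ τ∈ M sep =
    ≤-reflexive (Separated-close close-pairs sep) , λ { (_ , () , _) }
    where
    open Matching M
    <1+n : ∀ {G x} → G ∈ facetsOf (initial n) → x ∈ G → x < suc n
    <1+n {x = x} G∈ x∈G = subst (x <_) vertexBound-initial (facet-bounded invariant G∈ x∈G)
    close-pairs : ∀ {a b} → a ∈ as → b ∈ bs → Close (initial n) a b
    close-pairs a∈ b∈ = close (<1+n σ∈ (as⊆σ a∈)) (<1+n τ∈ (bs⊆τ b∈))

module Subdivision {n} (n≥3 : 3 ≤ n) {S : State} {e : Tagged} (e∈S : e ∈ facets S) (inv : Invariant n S) where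

  S⁺ : State
  S⁺ = subdivide n S e∈S

  k : ℕ
  k = steps S

  v : ℕ
  v = suc n + k

  F : Facet
  F = proj₂ e

  newFacet : ℕ → Facet
  newFacet u = v ∷ F without u

  open WellFormed (well-formed⁻ inv e∈S) using (tag≡creator) renaming (unique to F!)

  F<v : ∀ {u} → u ∈ F → u < v
  F<v = facet-bounded inv (tagged⁺ S e∈S)

  u≢v : ∀ {u} → u ∈ F → u ≢ v
  u≢v u∈F = <⇒≢ (F<v u∈F)

  3≤|F| : 3 ≤ length F
  3≤|F| = subst (3 ≤_) (sym (facet-size inv (tagged⁺ S e∈S))) n≥3

  steps⁺ : steps S⁺ ≡ suc k
  steps⁺ = trans (List.length-++ (parents S)) (+-comm k 1)

  vertexBound⁺ : vertexBound n S⁺ ≡ suc v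
  vertexBound⁺ = trans (cong (suc n +_) steps⁺) (+-suc (suc n) k)

  new∈ : ∀ {u} → u ∈ F → (just k , newFacet u) ∈ facets S⁺
  new∈ u∈F = ∈-++⁺ʳ (facets S Any.─ e∈S) (∈-map⁺ (λ u → just k , newFacet u) u∈F)

  old∈ : ∀ {tG} → tG ∈ facets S → tG ≢ e → tG ∈ facets S⁺
  old∈ tG∈ tG≢e with ∈-─⁻ e∈S tG∈
  ... | inj₁ tG≡e = ⊥-elim (tG≢e tG≡e)
  ... | inj₂ tG∈─ = ∈-++⁺ˡ tG∈─

  facets⁺⁻ : ∀ {tG} → tG ∈ facets S⁺ →
             tG ∈ facets S ⊎ ∃[ u ] u ∈ F × tG ≡ (just k , newFacet u)
  facets⁺⁻ tG∈ with ∈-++⁻ (facets S Any.─ e∈S) tG∈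
  ... | inj₁ tG∈─   = inj₁ (─-⊆ e∈S tG∈─)
  ... | inj₂ tG∈new = inj₂ (∈-map⁻ (λ u → just k , newFacet u) tG∈new)

  v∉old : ∀ {t G} → (t , G) ∈ facets S → v ∉ G
  v∉old tG∈ v∈G = <-irrefl refl (facet-bounded inv (tagged⁺ S tG∈) v∈G)

  facet⁺ : ∀ {G} → G ∈ facetsOf S → G ≢ F → G ∈ facetsOf S⁺
  facet⁺ {G} G∈ G≢F = tagged⁺ S⁺ (old∈ (proj₂ (tagged⁻ S G∈)) (G≢F ∘ cong proj₂))

  old-facet : ∀ {G} → G ∈ facetsOf S⁺ → v ∉ G → G ∈ facetsOf S
  old-facet G∈ v∉G with tagged⁻ S⁺ G∈
  ... | _ , tG∈ with facets⁺⁻ tG∈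
  ... | inj₁ tG∈S           = tagged⁺ S tG∈S
  ... | inj₂ (_ , _ , refl) = ⊥-elim (v∉G (here refl))

  new-facet : ∀ {G} → G ∈ facetsOf S⁺ → v ∈ G → ∃[ u ] u ∈ F × G ≡ newFacet u × G ∈ Top S⁺ k
  new-facet G∈ v∈G with tagged⁻ S⁺ G∈
  ... | _ , tG∈ with facets⁺⁻ tG∈
  ... | inj₁ tG∈S             = ⊥-elim (v∉old tG∈S v∈G)
  ... | inj₂ (u , u∈F , refl) = u , u∈F , refl , Top⁺ {S⁺} tG∈

  ∈-newFacet : ∀ {x w} → x ∈ v ∷ F → x ≢ w → x ∈ newFacet w
  ∈-newFacet (here refl) _   = here refl
  ∈-newFacet (there x∈F) x≢w = there (∈-without⁺ x∈F x≢w)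

  Adj-mono : ∀ {a b} → Adj S a b → Adj S⁺ a b
  Adj-mono {a} {b} (a≢b , G , G∈ , a∈G , b∈G) with List.≡-dec _≟_ G F
  ... | no  G≢F  = a≢b , G , facet⁺ G∈ G≢F , a∈G , b∈G
  ... | yes refl with avoiding₂ F! 3≤|F| a b
  ... | w , w∈F , w≢a , w≢b =
    a≢b , newFacet w , tagged⁺ S⁺ (new∈ w∈F) ,
    ∈-newFacet (there a∈G) (≢-sym w≢a) , ∈-newFacet (there b∈G) (≢-sym w≢b)

  Adj-new : ∀ {u} → u ∈ F → Adj S⁺ v u
  Adj-new {u} u∈F with avoiding₂ F! 3≤|F| u u
  ... | w , w∈F , w≢u , _ =
    ≢-sym (u≢v u∈F) , newFacet w , tagged⁺ S⁺ (new∈ w∈F) ,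
    here refl , ∈-newFacet (there u∈F) (≢-sym w≢u)

  new-well-formed : ∀ {u} → u ∈ F → WellFormed n (vertexBound n S⁺) (just k , newFacet u)
  new-well-formed {u} u∈F = record
    { tag≡creator = sym (creator-new {xs = F without u})
    ; size        = trans (length-without F F! u∈F) (facet-size inv (tagged⁺ S e∈S))
    ; unique      = All.tabulate (≢-sym ∘ u≢v ∘ ∈F) ∷ Unique-without F!
    ; bounded     = v<B⁺ ∷ All.tabulate (λ w∈ → <-trans (F<v (∈F w∈)) v<B⁺)
    }
    where
    ∈F : ∀ {w} → w ∈ F without u → w ∈ F
    ∈F = proj₁ ∘ ∈-without⁻ {u = u} {F}
    v<B⁺ : v < vertexBound n S⁺
    v<B⁺ = subst (v <_) (sym vertexBound⁺) (n<1+n v)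

  in-two-new-facets : ∀ {x} → x ∈ v ∷ F → InTwoFacets S⁺ x
  in-two-new-facets {x} x∈vF with two-omissions F! 3≤|F| x
  ... | w₁ , w₂ , w₁∈F , w₂∈F , w₁≢w₂ , x≢w₁ , x≢w₂ =
    newFacet w₁ , newFacet w₂ , tagged⁺ S⁺ (new∈ w₁∈F) , tagged⁺ S⁺ (new∈ w₂∈F) ,
    without-≢ w₁∈F w₁≢w₂ ∘ List.∷-injectiveʳ ,
    ∈-newFacet x∈vF x≢w₁ , ∈-newFacet x∈vF x≢w₂

  in-two-old-facets : ∀ {x} → x ∉ F → InTwoFacets S x → InTwoFacets S⁺ x
  in-two-old-facets x∉F (G₁ , G₂ , G₁∈ , G₂∈ , G₁≢G₂ , x∈G₁ , x∈G₂) =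
    G₁ , G₂ , facet⁺ G₁∈ (λ { refl → x∉F x∈G₁ }) , facet⁺ G₂∈ (λ { refl → x∉F x∈G₂ }) ,
    G₁≢G₂ , x∈G₁ , x∈G₂

  in-two-facets⁺ : ∀ x → x < vertexBound n S⁺ → InTwoFacets S⁺ x
  in-two-facets⁺ x x<B⁺ with x ∈? v ∷ F
  ... | yes x∈vF = in-two-new-facets x∈vF
  ... | no  x∉vF = in-two-old-facets (x∉vF ∘ there) (Invariant.in-two-facets inv x x<v)
    where
    x<v : x < v
    x<v = ≤∧≢⇒< (≤-pred (subst (x <_) vertexBound⁺ x<B⁺)) (x∉vF ∘ here)

  invariant⁺ : Invariant n S⁺
  invariant⁺ = record
    { well-formed   = All.tabulate well-formed⁺
    ; in-two-facets = in-two-facets⁺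
    }
    where
    B≤B⁺ : vertexBound n S ≤ vertexBound n S⁺
    B≤B⁺ = subst (v ≤_) (sym vertexBound⁺) (n≤1+n v)
    well-formed⁺ : ∀ {tG} → tG ∈ facets S⁺ → WellFormed n (vertexBound n S⁺) tG
    well-formed⁺ tG∈ with facets⁺⁻ tG∈
    ... | inj₁ tG∈S             = WellFormed-weaken B≤B⁺ (well-formed⁻ inv tG∈S)
    ... | inj₂ (u , u∈F , refl) = new-well-formed u∈F

  stacks⁺⁻ : ∀ {j} → j ∈ stacks S⁺ → j ≡ k ⊎ (j ∈ stacks S × proj₁ e ≢ just j)
  stacks⁺⁻ {j} j∈ with ∈-stacks⁻ {S⁺} j∈
  ... | j<1+k , notParent with m<1+n⇒m<n∨m≡n (subst (j <_) steps⁺ j<1+k)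
  ... | inj₂ j≡k = inj₁ j≡k
  ... | inj₁ j<k =
    inj₂ (∈-stacks⁺ {S} j<k (notParent ∘ AnyP.++⁺ˡ) , notParent ∘ AnyP.++⁺ʳ (parents S) ∘ here)

  Top-keep : ∀ {G j} → G ∈ Top S j → proj₁ e ≢ just j → G ∈ Top S⁺ j
  Top-keep G∈Top tag≢j = Top⁺ {S⁺} (old∈ (Top⁻ {S} G∈Top) (tag≢j ∘ sym ∘ cong proj₁))

  F-Top : ∀ {j} → F ∈ Top S j → proj₁ e ≡ just j
  F-Top F∈Top = trans tag≡creator (Top-creator inv F∈Top)

  uncovered⁻ : ∀ {σ τ} → σ ∈ Top S⁺ k → Uncovered S⁺ σ τ → Uncovered S F τ
  uncovered⁻ σ∈Top (j , j∈ , σ∉Top , τ∉Top) with stacks⁺⁻ j∈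
  ... | inj₁ refl          = ⊥-elim (σ∉Top σ∈Top)
  ... | inj₂ (j∈S , tag≢j) = j , j∈S , tag≢j ∘ F-Top , λ τ∈Top → τ∉Top (Top-keep τ∈Top tag≢j)

  u∉newFacet : ∀ {u} → u ∈ F → u ∉ newFacet u
  u∉newFacet u∈F (here u≡v)  = u≢v u∈F u≡v
  u∉newFacet u∈F (there u∈F∖u) = proj₂ (∈-without⁻ {F = F} u∈F∖u) refl

  replace-∈ : ∀ {u a} → u ∈ F → a ∈ newFacet u → replace v u a ∈ F
  replace-∈ {u} u∈F (here refl)     = subst (_∈ F) (sym (replace-self v u)) u∈F
  replace-∈ {u} u∈F (there a∈F∖u) = subst (_∈ F) (sym (replace-≢ (u≢v a∈F))) a∈F
    where
    a∈F = proj₁ (∈-without⁻ {F = F} a∈F∖u)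

  Matching-replaceˡ : ∀ {u τ as bs} → u ∈ F → Matching (newFacet u) τ as bs →
                      Matching F τ (map (replace v u) as) bs
  Matching-replaceˡ {u} u∈F M = record
    { as⊆σ      = λ a′∈ → case ∈-map⁻ (replace v u) a′∈ of λ where
                    (a , a∈as , refl) → replace-∈ u∈F (as⊆σ a∈as)
    ; bs⊆τ      = bs⊆τ
    ; as-unique = Unique-map-replace as-unique (u∉newFacet u∈F ∘ as⊆σ)
    ; bs-unique = bs-unique
    }
    where open Matching M

  Apart-drop : ∀ {u l b} → u ∈ F → Apart S⁺ l v b → Apart S (pred l) u b
  Apart-drop u∈F apart₀                      = apart₀
  Apart-drop u∈F (apart₁ _ _)                = apart₀
  Apart-drop u∈F (apart₂ (_ , ¬adj , ¬path)) =
    apart₁ (λ { refl → ¬adj (Adj-new u∈F) }) (λ adj → ¬path (_ , Adj-new u∈F , Adj-mono adj))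

  -- As the as are distinct, only one pair has v on its left, and only that pair can lose a level.
  Separated-replaceˡ : ∀ {u as bs m} → u ∈ F → Unique as → Separated S⁺ as bs m →
                       ∃[ m′ ] Separated S (map (replace v u) as) bs m′ × m ≤ suc m′
  Separated-replaceˡ u∈F [] [] = 0 , [] , z≤n
  Separated-replaceˡ {u} {a ∷ as} u∈F (a∉as ∷ as!) (_∷_ {l} {b = b} {m = m} ap sep) with a ≟ v
  ... | yes a≡v =
    pred l + m , subst (λ xs → Separated S (u ∷ xs) (b ∷ _) (pred l + m)) (sym (map-replace-∉ v∉as))
                       (Apart-drop u∈F (subst (λ x → Apart S⁺ l x b) a≡v ap) ∷ Separated-mono Adj-mono sep) ,
    +-monoˡ-≤ m (≤1+pred l)
    where
    v∉as : v ∉ as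
    v∉as v∈as = All.lookup a∉as v∈as a≡v
    ≤1+pred : ∀ l → l ≤ suc (pred l)
    ≤1+pred zero    = z≤n
    ≤1+pred (suc l) = ≤-refl
  ... | no _ with Separated-replaceˡ u∈F as! sep
  ... | m′ , sep′ , m≤1+m′ =
    l + m′ , Apart-mono Adj-mono ap ∷ sep′ , ≤-trans (+-monoʳ-≤ l m≤1+m′) (≤-reflexive (+-suc l m′))

  module _ {σ τ} (σ∈ : σ ∈ facetsOf S⁺) (τ∈ : τ ∈ facetsOf S⁺) (v∈σ : v ∈ σ) (v∈τ : v ∈ τ)
           (u u′ : ℕ) where

    -- A pair containing the common vertex v of σ and τ already has level 0.
    level₀ : ∀ {l a b x y} → Apart S⁺ l a b → Close S⁺ a b → Apart S l x y
    level₀ ap close rewrite Apart-close ap close = apart₀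

    Apart-replace-both : ∀ {l a b} → a ∈ σ → b ∈ τ → Apart S⁺ l a b →
                         Apart S l (replace v u a) (replace v u′ b)
    Apart-replace-both {a = a} {b} a∈σ b∈τ ap with a ≟ v | b ≟ v
    ... | yes a≡v | _       = level₀ ap (Close-cofacial {S⁺} τ∈ (subst (_∈ τ) (sym a≡v) v∈τ) b∈τ)
    ... | no  _   | yes b≡v = level₀ ap (Close-cofacial {S⁺} σ∈ a∈σ (subst (_∈ σ) (sym b≡v) v∈σ))
    ... | no  _   | no  _   = Apart-mono Adj-mono ap

    Separated-replace-both : ∀ {as bs m} → as ⊆ σ → bs ⊆ τ → Separated S⁺ as bs m →
                             Separated S (map (replace v u) as) (map (replace v u′) bs) m
    Separated-replace-both as⊆σ bs⊆τ []         = []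
    Separated-replace-both as⊆σ bs⊆τ (ap ∷ sep) =
      Apart-replace-both (as⊆σ (here refl)) (bs⊆τ (here refl)) ap ∷
      Separated-replace-both (as⊆σ ∘ there) (bs⊆τ ∘ there) sep

  Bound⁺ : Facet → Facet → ℕ → Set
  Bound⁺ σ τ m = m ≤ suc k × (Uncovered S⁺ σ τ → m < suc k)

  Bound⁺-sym : ∀ {σ τ m} → Bound⁺ σ τ m → Bound⁺ τ σ m
  Bound⁺-sym (m≤1+k , uncovered⇒) = m≤1+k , uncovered⇒ ∘ Uncovered-sym {S⁺}

  Bound⁺-≤k : ∀ {σ τ m} → m ≤ k → Bound⁺ σ τ m
  Bound⁺-≤k m≤k = m≤n⇒m≤1+n m≤k , λ _ → s≤s m≤k

  module _ (ih : ∀ {σ τ as bs m} → σ ∈ facetsOf S → τ ∈ facetsOf S → Matching σ τ as bs →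
                 Separated S as bs m → SeparationBound S σ τ m) where

    F∈ : F ∈ facetsOf S
    F∈ = tagged⁺ S e∈S

    bound-old : ∀ {σ τ as bs m} → σ ∈ facetsOf S⁺ → τ ∈ facetsOf S⁺ → Matching σ τ as bs →
                Separated S⁺ as bs m → v ∉ σ → v ∉ τ → Bound⁺ σ τ m
    bound-old σ∈ τ∈ M sep v∉σ v∉τ =
      Bound⁺-≤k (proj₁ (ih (old-facet σ∈ v∉σ) (old-facet τ∈ v∉τ) M (Separated-mono Adj-mono sep)))

    bound-left : ∀ {σ τ as bs m} → σ ∈ facetsOf S⁺ → τ ∈ facetsOf S⁺ → Matching σ τ as bs →
                 Separated S⁺ as bs m → v ∈ σ → v ∉ τ → Bound⁺ σ τ m
    bound-left σ∈ τ∈ M sep v∈σ v∉τ with new-facet σ∈ v∈σ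
    ... | u , u∈F , refl , σ∈Top with Separated-replaceˡ u∈F (Matching.as-unique M) sep
    ... | m′ , sep′ , m≤1+m′ with ih F∈ (old-facet τ∈ v∉τ) (Matching-replaceˡ u∈F M) sep′
    ... | m′≤k , uncovered⇒m′<k =
      ≤-trans m≤1+m′ (s≤s m′≤k) ,
      λ unc → ≤-trans (s≤s m≤1+m′) (s≤s (uncovered⇒m′<k (uncovered⁻ σ∈Top unc)))

    bound-both : ∀ {σ τ as bs m} → σ ∈ facetsOf S⁺ → τ ∈ facetsOf S⁺ → Matching σ τ as bs →
                 Separated S⁺ as bs m → v ∈ σ → v ∈ τ → Bound⁺ σ τ m
    bound-both σ∈ τ∈ M sep v∈σ v∈τ with new-facet σ∈ v∈σ | new-facet τ∈ v∈τ
    ... | u , u∈F , refl , _ | u′ , u′∈F , refl , _ =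
      Bound⁺-≤k (proj₁ (ih F∈ F∈ M′ sep′))
      where
      open Matching M
      M′ = Matching-sym (Matching-replaceˡ u′∈F (Matching-sym (Matching-replaceˡ u∈F M)))
      sep′ = Separated-replace-both σ∈ τ∈ v∈σ v∈τ u u′ as⊆σ bs⊆τ sep

    separation-bound⁺ : ∀ {σ τ as bs m} → σ ∈ facetsOf S⁺ → τ ∈ facetsOf S⁺ → Matching σ τ as bs →
                        Separated S⁺ as bs m → SeparationBound S⁺ σ τ m
    separation-bound⁺ {σ} {τ} {m = m} σ∈ τ∈ M sep =
      subst (λ K → m ≤ K × (Uncovered S⁺ σ τ → m < K)) (sym steps⁺) (by-cases (v ∈? σ) (v ∈? τ))
      where
      by-cases : Dec (v ∈ σ) → Dec (v ∈ τ) → Bound⁺ σ τ m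
      by-cases (no  v∉σ) (no  v∉τ) = bound-old σ∈ τ∈ M sep v∉σ v∉τ
      by-cases (yes v∈σ) (no  v∉τ) = bound-left σ∈ τ∈ M sep v∈σ v∉τ
      by-cases (no  v∉σ) (yes v∈τ) =
        Bound⁺-sym (bound-left τ∈ σ∈ (Matching-sym M) (Separated-sym sep) v∈τ v∉σ)
      by-cases (yes v∈σ) (yes v∈τ) = bound-both σ∈ τ∈ M sep v∈σ v∈τ

invariant : ∀ {n S} → 3 ≤ n → Stacked n S → Invariant n S
invariant n≥3 init              = Initial.invariant n≥3
invariant n≥3 (sub stacked e∈S) = Subdivision.invariant⁺ n≥3 e∈S (invariant n≥3 stacked)

separation-bound : ∀ {n S} → 3 ≤ n → Stacked n S →
                   ∀ {σ τ as bs m} → σ ∈ facetsOf S → τ ∈ facetsOf S → Matching σ τ as bs →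
                   Separated S as bs m → SeparationBound S σ τ m
separation-bound n≥3 init              = Initial.separation-bound n≥3
separation-bound n≥3 (sub stacked e∈S) =
  Subdivision.separation-bound⁺ n≥3 e∈S (invariant n≥3 stacked) (separation-bound n≥3 stacked)

identify-∉ : ∀ {y} xs ys → y ∉ ys → identify (zip xs ys) y ≡ y
identify-∉ []       _        _   = refl
identify-∉ (_ ∷ _)  []       _   = refl
identify-∉ {y} (_ ∷ xs) (b ∷ ys) y∉ with b ≟ y
... | yes b≡y = ⊥-elim (y∉ (here (sym b≡y)))
... | no  _   = identify-∉ xs ys (y∉ ∘ there)

module Handle {n Δ} (inv : Invariant n Δ) (h : HandleAddition Δ) where

  verticesOfM : List ℕ
  verticesOfM = concat (handleFacets Δ h)

  kept : ∀ {y G} → y ∉ τ h → G ∈ facetsOf Δ → G ≢ σ h → y ∈ G → y ∈ verticesOfM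
  kept {y} {G} y∉τ G∈ G≢σ y∈G =
    ∈-concat⁺′ (subst (_∈ map identifyM G) y-fixed (∈-map⁺ _ y∈G))
               (∈-map⁺ _ (∈-filter⁺ _ G∈ (G≢σ , λ G≡τ → y∉τ (subst (y ∈_) G≡τ y∈G))))
    where
    identifyM = identify (zip (σ h) (τ' h))
    y-fixed : identifyM y ≡ y
    y-fixed = identify-∉ (σ h) (τ' h) (y∉τ ∘ ∈-resp-↭ (perm h))

  -- A vertex outside τ is not identified with anything and lies in a facet other than σ.
  survives : ∀ {y} → y < vertexBound n Δ → y ∉ τ h → y ∈ verticesOfM
  survives {y} y<B y∉τ with Invariant.in-two-facets inv y y<B
  ... | G₁ , G₂ , G₁∈ , G₂∈ , G₁≢G₂ , y∈G₁ , y∈G₂ with List.≡-dec _≟_ G₁ (σ h)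
  ... | no  G₁≢σ = kept y∉τ G₁∈ G₁≢σ y∈G₁
  ... | yes G₁≡σ = kept y∉τ G₂∈ (λ G₂≡σ → G₁≢G₂ (trans G₁≡σ (sym G₂≡σ))) y∈G₂

  vertices⊆ : upTo (vertexBound n Δ) ⊆ τ h ++ deduplicate _≟_ verticesOfM
  vertices⊆ {y} y∈ with y ∈? τ h
  ... | yes y∈τ = ∈-++⁺ˡ y∈τ
  ... | no  y∉τ = ∈-++⁺ʳ (τ h) (∈-deduplicate⁺ _≟_ (survives (∈-upTo⁻ y∈) y∉τ))

  steps≤2n : IsMISS n Δ h → steps Δ ≤ 2 * n
  steps≤2n miss = +-cancelˡ-≤ (suc n) (steps Δ) (2 * n) (begin
    suc n + steps Δ                             ≡⟨ List.length-upTo (vertexBound n Δ) ⟨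
    length (upTo (vertexBound n Δ))             ≤⟨ Unique-⊆⇒length≤ (Unique.upTo⁺ _) vertices⊆ ⟩
    length (τ h ++ deduplicate _≟_ verticesOfM) ≡⟨ List.length-++ (τ h) ⟩
    length (τ h) + handleVertexCount Δ h        ≡⟨ cong₂ _+_ (facet-size inv (τ∈ h)) miss ⟩
    n + (2 * n + 1)                             ≡⟨ cong (n +_) (+-comm (2 * n) 1) ⟩
    n + suc (2 * n)                             ≡⟨ +-suc n (2 * n) ⟩
    suc n + 2 * n                               ∎)
    where open ≤-Reasoning

  matching : Matching (σ h) (τ h) (σ h) (τ' h)
  matching = record
    { as⊆σ      = λ a∈ → a∈
    ; bs⊆τ      = ∈-resp-↭ (perm h)
    ; as-unique = facet-unique inv (σ∈ h)
    ; bs-unique = Unique-resp-↭ (setoid ℕ) (↭⇒↭ₛ (↭-sym (perm h))) (facet-unique inv (τ∈ h))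
    }

  separated : Separated Δ (σ h) (τ' h) (2 * n)
  separated = subst (Separated Δ (σ h) (τ' h)) (cong (2 *_) (facet-size inv (σ∈ h)))
                    (Separated-far (σ h) (τ' h) |σ|≡|τ'| (far h))
    where
    |σ|≡|τ'| : length (σ h) ≡ length (τ' h)
    |σ|≡|τ'| = trans (facet-size inv (σ∈ h)) (sym (trans (↭-length (perm h)) (facet-size inv (τ∈ h))))

proposition3p3 : (n : ℕ) → 4 ≤ n → (Δ : State) → Stacked n Δ →
    (h : HandleAddition Δ) → IsMISS n Δ h →
    (length (stacks Δ) ≤ 2) ×
    (∀ i → i ∈ stacks Δ → σ h ∈ Top Δ i ⊎ τ h ∈ Top Δ i)
proposition3p3 n 4≤n Δ stacked h miss = length-stacks-≤2 inv covered , covered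
  where
  n≥3 : 3 ≤ n
  n≥3 = ≤-trans (n≤1+n 3) 4≤n
  inv : Invariant n Δ
  inv = invariant n≥3 stacked
  open Handle inv h
  no-uncovered : ¬ Uncovered Δ (σ h) (τ h)
  no-uncovered uncovered = <⇒≱ (2n<steps uncovered) (steps≤2n miss)
    where
    2n<steps = proj₂ (separation-bound n≥3 stacked (σ∈ h) (τ∈ h) matching separated)
  covered : ∀ i → i ∈ stacks Δ → σ h ∈ Top Δ i ⊎ τ h ∈ Top Δ i
  covered i i∈ with σ h ∈ᶠ? Top Δ i | τ h ∈ᶠ? Top Δ i
  ... | yes σ∈Top | _         = inj₁ σ∈Top
  ... | no  _     | yes τ∈Top = inj₂ τ∈Top
  ... | no  σ∉Top | no  τ∉Top = ⊥-elim (no-uncovered (i , i∈ , σ∉Top , τ∉Top))
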